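{- A set of two partial implications $X_1\to Y_1, X_2\to Y_2$ on $[n]$ enforces homogeneity if and only if both $X_1\subseteq X_2Y_2$ and $X_2\subseteq X_1Y_1$.
   Context: A partial implication $X\to Y$ is a pair of subsets of $[n]$; $XY=X\cup Y$. A set $X_1\to Y_1,\ldots,X_k\to Y_k$ enforces homogeneity if for every $Z\subseteq[n]$: if for all $i\in[k]$ either $X_i\not\subseteq Z$ or $X_iY_i\subseteq Z$, then either $X_i\not\subseteq Z$ for all $i\in[k]$, or $X_iY_i\subseteq Z$ for all $i\in[k]$. -}

module Defs where

open import Data.Nat using (ℕ)
open import Data.Fin using (Fin)
import Data.Fin as Fin
open import Data.Fin.Subset using (Subset; _⊆_; _∪_)
open import Data.Product using (_×_; _,_)
open import Data.Sum using (_⊎_)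
open import Relation.Nullary using (¬_)

record PImp (n : ℕ) : Set where
  constructor _⇒_
  field
    lhs : Subset n
    rhs : Subset n
open PImp public

XY : ∀ {n} → PImp n → Subset n
XY i = lhs i ∪ rhs i

Respects : ∀ {n} → Subset n → PImp n → Set
Respects Z i = (¬ (lhs i ⊆ Z)) ⊎ (XY i ⊆ Z)

EnforcesHomogeneity : ∀ {n k} → (Fin k → PImp n) → Set
EnforcesHomogeneity {n} imps =
  (Z : Subset n) →
  (∀ i → Respects Z (imps i)) →
  (∀ i → ¬ (lhs (imps i) ⊆ Z)) ⊎ (∀ i → XY (imps i) ⊆ Z)

pair : ∀ {n} → PImp n → PImp n → Fin 2 → PImp n
pair a b Fin.zero = a
pair a b (Fin.suc _) = b

module Submission where

-- If a's premise is not contained in XY b, then the test set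
-- Z = XY b respects both implications (a because its premise escapes Z, b
-- because its closure is Z), yet b fires on Z while a does not, so Z is not
-- homogeneous.  Since enforcing homogeneity is symmetric in the two
-- implications, the same argument with a and b swapped gives the other
-- inclusion.
--
-- Let Z respect both implications and decide whether X₁ ⊆ Z.
-- If so, a fires, hence X₁Y₁ ⊆ Z, hence X₂ ⊆ Z, so b fires as well.  If not,
-- b cannot fire either, since X₂Y₂ ⊆ Z would give X₁ ⊆ Z.

open import Defs
open import Data.Nat using (ℕ)
open import Data.Fin using (zero; suc)
open import Data.Fin.Subset using (Subset; _⊆_; _∪_)
open import Data.Fin.Subset.Properties using (_⊆?_; p⊆p∪q; ⊆-refl; ⊆-trans)
open import Data.Product using (_×_; _,_)
open import Data.Sum using (inj₁; inj₂)
open import Data.Empty using (⊥-elim)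
open import Relation.Nullary using (¬_; yes; no)
open import Function.Bundles using (_⇔_; mk⇔)

module _ {n : ℕ} where

  Fires : Subset n → PImp n → Set
  Fires Z i = lhs i ⊆ Z

  lhs⊆XY : (i : PImp n) → lhs i ⊆ XY i
  lhs⊆XY i = p⊆p∪q (rhs i)

  fired⇒XY⊆ : ∀ {Z} (i : PImp n) → Respects Z i → Fires Z i → XY i ⊆ Z
  fired⇒XY⊆ i (inj₁ silent) fires = ⊥-elim (silent fires)
  fired⇒XY⊆ i (inj₂ closed) fires = closed

  onPair : ∀ {a b : PImp n} (P : PImp n → Set) → P a → P b → ∀ i → P (pair a b i)
  onPair P pa pb zero    = pa
  onPair P pa pb (suc _) = pb

  pair-swap : ∀ {a b : PImp n} →
    EnforcesHomogeneity (pair a b) → EnforcesHomogeneity (pair b a)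
  pair-swap {a} {b} enforces Z respects
    with enforces Z (onPair (Respects Z) (respects (suc zero)) (respects zero))
  ... | inj₁ silent = inj₁ (onPair (λ i → ¬ Fires Z i) (silent (suc zero)) (silent zero))
  ... | inj₂ closed = inj₂ (onPair (λ i → XY i ⊆ Z) (closed (suc zero)) (closed zero))

  -- Necessity: if `pair a b` enforces homogeneity, a's premise lies in XY b.
  -- Test set Z = XY b: a is respected if its premise escapes Z, b always is.
  enforces⇒lhs⊆XY : ∀ (a b : PImp n) →
    EnforcesHomogeneity (pair a b) → lhs a ⊆ XY b
  enforces⇒lhs⊆XY a b enforces with lhs a ⊆? XY b
  ... | yes inside = inside
  ... | no escapes
    with enforces (XY b) (onPair (Respects (XY b)) (inj₁ escapes) (inj₂ ⊆-refl))
  ...   | inj₁ silent = ⊥-elim (silent (suc zero) (lhs⊆XY b))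
  ...   | inj₂ closed = ⊥-elim (escapes (⊆-trans (lhs⊆XY a) (closed zero)))

  lhs⊆XY⇒enforces : ∀ (a b : PImp n) →
    lhs a ⊆ XY b → lhs b ⊆ XY a → EnforcesHomogeneity (pair a b)
  lhs⊆XY⇒enforces a b a⊆XYb b⊆XYa Z respects with lhs a ⊆? Z
  ... | yes a-fires = inj₂ (onPair (λ i → XY i ⊆ Z) XYa⊆Z XYb⊆Z)
    where
    XYa⊆Z : XY a ⊆ Z
    XYa⊆Z = fired⇒XY⊆ a (respects zero) a-fires
    XYb⊆Z : XY b ⊆ Z
    XYb⊆Z = fired⇒XY⊆ b (respects (suc zero)) (⊆-trans b⊆XYa XYa⊆Z)
  ... | no a-silent = inj₁ (onPair (λ i → ¬ Fires Z i) a-silent b-silent)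
    where
    b-silent : ¬ Fires Z b
    b-silent b-fires =
      a-silent (⊆-trans a⊆XYb (fired⇒XY⊆ b (respects (suc zero)) b-fires))

lemma5 : (n : ℕ) (X₁ Y₁ X₂ Y₂ : Subset n) →
    EnforcesHomogeneity (pair (X₁ ⇒ Y₁) (X₂ ⇒ Y₂))
      ⇔ ((X₁ ⊆ (X₂ ∪ Y₂)) × (X₂ ⊆ (X₁ ∪ Y₁)))
lemma5 n X₁ Y₁ X₂ Y₂ = mk⇔ necessity sufficiency
  where
  a b : PImp n
  a = X₁ ⇒ Y₁
  b = X₂ ⇒ Y₂

  necessity : EnforcesHomogeneity (pair a b) → (X₁ ⊆ X₂ ∪ Y₂) × (X₂ ⊆ X₁ ∪ Y₁)
  necessity enforces =
    enforces⇒lhs⊆XY a b enforces , enforces⇒lhs⊆XY b a (pair-swap enforces)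

  sufficiency : (X₁ ⊆ X₂ ∪ Y₂) × (X₂ ⊆ X₁ ∪ Y₁) → EnforcesHomogeneity (pair a b)
  sufficiency (a⊆XYb , b⊆XYa) = lhs⊆XY⇒enforces a b a⊆XYb b⊆XYa
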